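{- Let $q$ be a prime power, $1\le k\le n-1$, $C$ a systematic $(n,k,q)$ code, and $t$ an integer with $2\le t\le n$. Let $B_{t-1}$ be the number of codewords of $C$ of Hamming weight exactly $t-1$. Then $$B_{t-1}=|\mathcal{V}(\mathcal{W}_C^t)|-|\mathcal{V}(\mathcal{W}_C^{t-1})|.$$
   Context: A systematic $(n,k,q)$ code is the image of an injective map $\phi:(\mathbb{F}_q)^k\to(\mathbb{F}_q)^n$ whose first $k$ output coordinates equal the input. Let $f_1,\dots,f_{n-k}\in\mathbb{F}_q[x_1,\dots,x_k]$ satisfy $C=\{(a,f_1(a),\dots,f_{n-k}(a))\mid a\in(\mathbb{F}_q)^k\}$. For $1\le s\le n$, $\mathcal{M}_{n,s}=\{y_{h_1}\cdots y_{h_s}\mid 1\le h_1<\dots<h_s\le n\}$, and $\mathcal{W}_C^s=\langle\{x_i^q-x_i\}_{1\le i\le k}\cup\{\mathsf{m}(x_1,\dots,x_k,f_1(X),\dots,f_{n-k}(X))\mid\mathsf{m}\in\mathcal{M}_{n,s}\}\rangle\subseteq\mathbb{F}_q[x_1,\dots,x_k]$, where the substitution is $y_i=x_i$ for $i\le k$ and $y_{k+j}=f_j(X)$. $\mathcal{V}(J)$ is the zero set of $J$ in $(\overline{\mathbb{F}}_q)^k$. -}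

module Defs where

open import Level using (0ℓ)
open import Data.Nat as ℕ using (ℕ; zero; suc)
open import Data.Fin using (Fin; zero; suc; splitAt)
open import Data.Fin.Subset using (Subset; inside; outside; ∣_∣)
open import Data.Vec as Vec using (Vec; []; _∷_; lookup; _++_)
open import Data.List as List using (List; []; _∷_; filter; allFin)
open import Data.List.Relation.Unary.All using (All)
open import Data.List.Relation.Unary.Any using (Any)
open import Data.Sum using (_⊎_; inj₁; inj₂)
open import Data.Product using (Σ; ∃; _×_; _,_)
open import Relation.Binary.PropositionalEquality using (_≡_; _≢_)
open import Relation.Nullary using (Dec; yes; no)
open import Relation.Binary using (DecidableEquality)
open import Algebra.Structures using (IsCommutativeRing)
open import Algebra.Core using (Op₁; Op₂)
open import Function.Bundles using (_↔_)
open import Function using (_∘_)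

record Field : Set₁ where
  infixl 6 _+_ _-_
  infixl 7 _*_
  field
    Carrier : Set
    _+_ _*_ : Op₂ Carrier
    -_      : Op₁ Carrier
    0# 1#   : Carrier
    isCommutativeRing : IsCommutativeRing _≡_ _+_ _*_ -_ 0# 1#
    0≢1     : 0# ≢ 1#
    inverse : ∀ x → x ≢ 0# → ∃ λ y → x * y ≡ 1#
    _≟_     : DecidableEquality Carrier

  _-_ : Op₂ Carrier
  x - y = x + (- y)

  _^_ : Carrier → ℕ → Carrier
  x ^ zero  = 1#
  x ^ suc n = x * (x ^ n)

open Field

-- A finite field with exactly q elements (q is then necessarily a prime power).
record FiniteField (q : ℕ) : Set₁ where
  field
    field′ : Field
    enum   : Carrier field′ ↔ Fin q
  open Field field′ public

-- Univariate polynomials as coefficient lists [a₀, a₁, …] (Horner evaluation)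

evalU : (K : Field) → List (Carrier K) → Carrier K → Carrier K
evalU K cs x = List.foldr (λ a acc → _+_ K a (_*_ K x acc)) (0# K) cs

record AlgebraicClosure (F : Field) : Set₁ where
  field
    K      : Field
    ι      : Carrier F → Carrier K
    ι-+    : ∀ x y → ι (_+_ F x y) ≡ _+_ K (ι x) (ι y)
    ι-*    : ∀ x y → ι (_*_ F x y) ≡ _*_ K (ι x) (ι y)
    ι-1    : ι (1# F) ≡ 1# K
    -- every monic polynomial of degree d+1 ≥ 1 over K has a root in K
    algClosed : ∀ d (cs : Vec (Carrier K) (suc d)) →
                ∃ λ x → _+_ K (_^_ K x (suc d)) (evalU K (Vec.toList cs) x) ≡ 0# K
    algebraic : ∀ y → ∃ λ (cs : List (Carrier F)) →
                Any (λ c → c ≢ 0# F) cs × evalU K (List.map ι cs) y ≡ 0# K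

infixl 6 _⊕_
infixl 7 _⊗_

data MPoly (A : Set) (k : ℕ) : Set where
  con  : A → MPoly A k
  var  : Fin k → MPoly A k
  _⊕_  : MPoly A k → MPoly A k → MPoly A k
  _⊗_  : MPoly A k → MPoly A k → MPoly A k
  neg  : MPoly A k → MPoly A k

evalM : ∀ {A k} (K : Field) → (A → Carrier K) → MPoly A k → Vec (Carrier K) k → Carrier K
evalM K ι (con a)  x = ι a
evalM K ι (var i)  x = lookup x i
evalM K ι (p ⊕ p′) x = _+_ K (evalM K ι p x) (evalM K ι p′ x)
evalM K ι (p ⊗ p′) x = _*_ K (evalM K ι p x) (evalM K ι p′ x)
evalM K ι (neg p)  x = -_ K (evalM K ι p x)

_⊖_ : ∀ {A k} → MPoly A k → MPoly A k → MPoly A k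
p ⊖ p′ = p ⊕ neg p′

powM : ∀ {A k} → A → MPoly A k → ℕ → MPoly A k
powM one p zero    = con one
powM one p (suc n) = p ⊗ powM one p n

allSubsets : (n : ℕ) → List (Subset n)
allSubsets zero    = [] ∷ []
allSubsets (suc n) = List.map (inside ∷_) (allSubsets n) List.++ List.map (outside ∷_) (allSubsets n)

subsetsOfSize : (n s : ℕ) → List (Subset n)
subsetsOfSize n s = filter (λ p → ∣ p ∣ ℕ.≟ s) (allSubsets n)

-- the monomial y_{h₁}⋯y_{h_s} for H = {h₁,…,h_s}, after substituting y_h := Y h
monomial : ∀ {A k n} → A → (Fin n → MPoly A k) → Subset n → MPoly A k
monomial one Y []            = con one
monomial one Y (inside ∷ p)  = Y zero ⊗ monomial one (Y ∘ suc) p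
monomial one Y (outside ∷ p) = monomial one (Y ∘ suc) p

-- Systematic codes given by f₁,…,f_{n-k} (here r = n - k, n = k + r)

module SystematicCode {q : ℕ} (𝔽 : FiniteField q) (k r : ℕ)
                      (fs : Vec (MPoly (FiniteField.Carrier 𝔽) k) r) where
  open FiniteField 𝔽 using (field′)
  F = field′
  Fq = Carrier F

  encode : Vec Fq k → Vec Fq (k ℕ.+ r)
  encode a = a ++ Vec.map (λ f → evalM F (λ c → c) f a) fs

  _∈C : Vec Fq (k ℕ.+ r) → Set
  c ∈C = ∃ λ a → encode a ≡ c

  weight : ∀ {n} → Vec Fq n → ℕ
  weight []       = 0
  weight (c ∷ cs) with _≟_ F c (0# F)
  ... | yes _ = weight cs
  ... | no  _ = suc (weight cs)

  CodewordsOfWeight : ℕ → Set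
  CodewordsOfWeight w = Σ (Vec Fq (k ℕ.+ r)) λ c → c ∈C × weight c ≡ w

  -- substitution y_i = x_i (i ≤ k), y_{k+j} = f_j(X)
  Y : Fin (k ℕ.+ r) → MPoly Fq k
  Y h with splitAt k h
  ... | inj₁ i = var i
  ... | inj₂ j = lookup fs j

  -- generators of W_C^s : {x_i^q - x_i} ∪ {m(X, f(X)) | m ∈ M_{n,s}}
  generators : ℕ → List (MPoly Fq k)
  generators s =
    List.map (λ i → powM (1# F) (var i) q ⊖ var i) (allFin k)
    List.++ List.map (monomial (1# F) Y) (subsetsOfSize (k ℕ.+ r) s)

  Variety : AlgebraicClosure F → ℕ → Set
  Variety K̄ s = Σ (Vec (Carrier K) k) λ x →
                  All (λ g → evalM K ι g x ≡ 0# K) (generators s)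
    where open AlgebraicClosure K̄

-- Write wt(a) for the Hamming weight of the codeword encode(a) of a message
-- a ∈ 𝔽_qᵏ. The proof identifies, for every s,
--   (1) V(W_C^s) with { a ∈ 𝔽_qᵏ | wt(a) < s }: the field equations
--       x_i^q - x_i force every coordinate of a point into the image of 𝔽_q
--       (Fermat's little theorem, plus the bound that Xᵠ - X has at most q
--       roots), and at an image point the products of s coordinates of the
--       codeword all vanish iff it has fewer than s nonzero entries;
--   (2) the codewords of weight s with { a | wt(a) = s }.
-- Since { wt < s+1 } = { wt < s } ⊎ { wt = s }, counting gives
-- |V(W_C^{s+1})| = |V(W_C^s)| + B_s, which is the theorem for t = s + 1.
-- The file develops: field facts, the root bound for polynomials, Fermat,
-- the embedding 𝔽_q → K̄, the two parametrisations, and the counting step.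
module Submission where

open import Defs
open import Algebra.Bundles using (CommutativeRing)
open import Data.Nat as ℕ using (ℕ; zero; suc)
open import Data.Nat.Properties using (+-comm)
open import Data.Fin as Fin using (Fin; zero; suc)
open import Data.Fin.Properties using (suc-injective; any?; +↔⊎; cantor-schröder-bernstein)
open import Data.Vec as Vec using (Vec; []; _∷_)
open import Data.Sum using (_⊎_; inj₁; inj₂)
open import Data.Sum.Function.Propositional using (_⊎-↔_)
open import Data.Product using (Σ; ∃; _×_; _,_; proj₁; proj₂)
open import Data.Empty using (⊥-elim)
open import Function using (_∘_)
open import Function.Definitions using (Injective)
open import Function.Bundles using (Inverse; Injection; _↔_; mk↔ₛ′)
open import Function.Properties.Inverse using (↔-sym; ↔⇒↣)
import Function.Related.Propositional as Related
open import Relation.Nullary using (yes; no; ¬_)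
open import Relation.Binary.PropositionalEquality

module FieldFacts (F : Field) where
  open Field F

  commutativeRing : CommutativeRing _ _
  commutativeRing = record { isCommutativeRing = isCommutativeRing }

  open CommutativeRing commutativeRing public
    using (+-identityˡ; +-identityʳ; +-assoc; -‿inverseʳ; -‿inverseˡ;
           *-identityˡ; *-identityʳ; *-assoc; *-comm; zeroˡ; zeroʳ;
           distribˡ; commutativeSemiring)
  open CommutativeRing commutativeRing using (+-group; ring)
  open import Algebra.Properties.Group +-group public
    using (x∙y⁻¹≈ε⇒x≈y; inverseˡ-unique)
  open import Algebra.Properties.Ring ring public
    using (-‿distribʳ-*; x+x≈x⇒x≈0)

  cancel-nonzero : ∀ {x y} → x ≢ 0# → x * y ≡ 0# → y ≡ 0#
  cancel-nonzero {x} {y} x≢0 xy≡0 with inverse x x≢0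
  ... | x⁻¹ , xx⁻¹≡1 = begin
    y              ≡⟨ sym (*-identityˡ y) ⟩
    1# * y         ≡⟨ cong (_* y) (trans (sym xx⁻¹≡1) (*-comm x x⁻¹)) ⟩
    (x⁻¹ * x) * y  ≡⟨ *-assoc x⁻¹ x y ⟩
    x⁻¹ * (x * y)  ≡⟨ cong (x⁻¹ *_) xy≡0 ⟩
    x⁻¹ * 0#       ≡⟨ zeroʳ x⁻¹ ⟩
    0#             ∎
    where open ≡-Reasoning

  nonzero-* : ∀ {x y} → x ≢ 0# → y ≢ 0# → x * y ≢ 0#
  nonzero-* x≢0 y≢0 xy≡0 = y≢0 (cancel-nonzero x≢0 xy≡0)

  cancelʳ : ∀ {x y u} → u ≢ 0# → x * u ≡ y * u → x ≡ y
  cancelʳ {x} {y} {u} u≢0 xu≡yu with inverse u u≢0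
  ... | u⁻¹ , uu⁻¹≡1 = begin
    x               ≡⟨ sym (*-identityʳ x) ⟩
    x * 1#          ≡⟨ cong (x *_) (sym uu⁻¹≡1) ⟩
    x * (u * u⁻¹)   ≡⟨ sym (*-assoc x u u⁻¹) ⟩
    (x * u) * u⁻¹   ≡⟨ cong (_* u⁻¹) xu≡yu ⟩
    (y * u) * u⁻¹   ≡⟨ *-assoc y u u⁻¹ ⟩
    y * (u * u⁻¹)   ≡⟨ cong (y *_) uu⁻¹≡1 ⟩
    y * 1#          ≡⟨ *-identityʳ y ⟩
    y               ∎
    where open ≡-Reasoning

  sub≡0⇒≡ : ∀ {x y} → x - y ≡ 0# → x ≡ y
  sub≡0⇒≡ {x} {y} = x∙y⁻¹≈ε⇒x≈y x y

  sub+cancel : ∀ x y → (x - y) + y ≡ x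
  sub+cancel x y = begin
    (x + - y) + y  ≡⟨ +-assoc x (- y) y ⟩
    x + (- y + y)  ≡⟨ cong (x +_) (-‿inverseˡ y) ⟩
    x + 0#         ≡⟨ +-identityʳ x ⟩
    x              ∎
    where open ≡-Reasoning

-- Polynomials over a field as coefficient vectors [c₀, c₁, …, cₙ], lowest
-- degree first. The only fact needed is the root bound: a polynomial of
-- degree ≤ n with n+1 distinct roots has vanishing leading coefficient. It is
-- proved by synthetic division by X - r, one root at a time.
module Polynomials (F : Field) where
  open Field F
  open FieldFacts F
  open import Algebra.Solver.Ring.NaturalCoefficients.Default commutativeSemiring

  eval : ∀ {n} → Vec Carrier n → Carrier → Carrier
  eval []       z = 0#
  eval (c ∷ cs) z = c + z * eval cs z

  eval-constant : ∀ c z → eval (c ∷ []) z ≡ c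
  eval-constant c z = trans (cong (c +_) (zeroʳ z)) (+-identityʳ c)

  -- the coefficient cₙ of the top slot of a vector of length n+1 (it may be 0)
  leading : ∀ {n} → Vec Carrier (suc n) → Carrier
  leading (c ∷ [])      = c
  leading (c ∷ c′ ∷ cs) = leading (c′ ∷ cs)

  leading-cons : ∀ {n} x (cs : Vec Carrier (suc n)) → leading (x ∷ cs) ≡ leading cs
  leading-cons x (c ∷ cs) = refl

  quotient : ∀ {n} → Carrier → Vec Carrier (suc n) → Vec Carrier n
  quotient {zero}  r (c ∷ [])   = []
  quotient {suc n} r (c ∷ rest) = eval rest r ∷ quotient r rest

  -- p(w + r) = p(r) + w · (p / (X - r))(w + r); stated with z = w + r so that
  -- the inductive step is an identity of commutative semirings
  division : ∀ {n} r w (cs : Vec Carrier (suc n)) →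
             eval cs (w + r) ≡ eval cs r + w * eval (quotient r cs) (w + r)
  division {zero} r w (c ∷ []) = base c w r 0#
    where
    base : ∀ c w r e → c + (w + r) * e ≡ (c + r * e) + w * e
    base = solve 4 (λ c w r e → c :+ (w :+ r) :* e := (c :+ r :* e) :+ w :* e) refl
  division {suc n} r w (c ∷ rest) = begin
    c + (w + r) * eval rest (w + r)  ≡⟨ cong (λ v → c + (w + r) * v) (division r w rest) ⟩
    c + (w + r) * (B + w * D)        ≡⟨ step c w r B D ⟩
    (c + r * B) + w * (B + (w + r) * D) ∎
    where
    open ≡-Reasoning
    B = eval rest r
    D = eval (quotient r rest) (w + r)
    step : ∀ c w r B D → c + (w + r) * (B + w * D) ≡ (c + r * B) + w * (B + (w + r) * D)
    step = solve 5 (λ c w r B D → c :+ (w :+ r) :* (B :+ w :* D)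
                                 := (c :+ r :* B) :+ w :* (B :+ (w :+ r) :* D)) refl

  root-of-quotient : ∀ {n} {r z} (cs : Vec Carrier (suc n)) →
                     eval cs r ≡ 0# → eval cs z ≡ 0# → z ≢ r → eval (quotient r cs) z ≡ 0#
  root-of-quotient {r = r} {z} cs pr≡0 pz≡0 z≢r =
    trans (cong Q (sym z≡w+r)) (cancel-nonzero w≢0 w*Q≡0)
    where
    open ≡-Reasoning
    Q = eval (quotient r cs)
    w = z - r
    z≡w+r = sub+cancel z r
    w≢0 : w ≢ 0#
    w≢0 w≡0 = z≢r (sub≡0⇒≡ w≡0)
    w*Q≡0 : w * Q (w + r) ≡ 0#
    w*Q≡0 = begin
      w * Q (w + r)              ≡⟨ sym (+-identityˡ _) ⟩
      0# + w * Q (w + r)         ≡⟨ cong (_+ w * Q (w + r)) (sym pr≡0) ⟩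
      eval cs r + w * Q (w + r)  ≡⟨ sym (division r w cs) ⟩
      eval cs (w + r)            ≡⟨ cong (eval cs) z≡w+r ⟩
      eval cs z                  ≡⟨ pz≡0 ⟩
      0#                         ∎

  -- dividing by the monic X - r preserves the leading coefficient
  leading-quotient : ∀ {n} r (cs : Vec Carrier (suc (suc n))) → leading (quotient r cs) ≡ leading cs
  leading-quotient {zero}  r (c ∷ c′ ∷ []) = eval-constant c′ r
  leading-quotient {suc n} r (c ∷ rest) =
    trans (leading-cons _ (quotient r rest))
          (trans (leading-quotient r rest) (sym (leading-cons c rest)))

  rootBound : ∀ n (cs : Vec Carrier (suc n)) (rs : Fin (suc n) → Carrier) →
              Injective _≡_ _≡_ rs → (∀ i → eval cs (rs i) ≡ 0#) → leading cs ≡ 0#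
  rootBound zero    (c ∷ []) rs _ roots = trans (sym (eval-constant c (rs zero))) (roots zero)
  rootBound (suc n) cs rs injective roots =
    trans (sym (leading-quotient (rs zero) cs))
          (rootBound n (quotient (rs zero) cs) (rs ∘ suc)
                     (λ e → suc-injective (injective e)) roots′)
    where
    roots′ : ∀ i → eval (quotient (rs zero) cs) (rs (suc i)) ≡ 0#
    roots′ i = root-of-quotient cs (roots zero) (roots (suc i)) (λ e → suc≢zero (injective e))
      where
      suc≢zero : suc i ≢ zero
      suc≢zero ()

  Xpow : ∀ n → Vec Carrier (suc n)
  Xpow zero    = 1# ∷ []
  Xpow (suc n) = 0# ∷ Xpow n

  eval-Xpow : ∀ n z → eval (Xpow n) z ≡ z ^ n
  eval-Xpow zero    z = eval-constant 1# z
  eval-Xpow (suc n) z = trans (+-identityˡ _) (cong (z *_) (eval-Xpow n z))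

  leading-Xpow : ∀ n → leading (Xpow n) ≡ 1#
  leading-Xpow zero    = refl
  leading-Xpow (suc n) = trans (leading-cons 0# (Xpow n)) (leading-Xpow n)

  XpowMinusX : ∀ m → Vec Carrier (suc (suc (suc m)))
  XpowMinusX m = 0# ∷ - 1# ∷ Xpow m

  root-XpowMinusX : ∀ m z → z ^ suc (suc m) ≡ z → eval (XpowMinusX m) z ≡ 0#
  root-XpowMinusX m z zᵠ≡z = begin
    0# + z * (- 1# + z * eval (Xpow m) z)  ≡⟨ +-identityˡ _ ⟩
    z * (- 1# + z * eval (Xpow m) z)       ≡⟨ cong (λ v → z * (- 1# + z * v)) (eval-Xpow m z) ⟩
    z * (- 1# + z ^ suc m)                 ≡⟨ distribˡ z (- 1#) _ ⟩
    z * - 1# + z ^ suc (suc m)             ≡⟨ cong₂ _+_ (sym (-‿distribʳ-* z 1#)) zᵠ≡z ⟩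
    - (z * 1#) + z                         ≡⟨ cong (λ v → - v + z) (*-identityʳ z) ⟩
    - z + z                                ≡⟨ -‿inverseˡ z ⟩
    0#                                     ∎
    where open ≡-Reasoning

  fixedPoints-bound : ∀ m (rs : Fin (suc (suc (suc m))) → Carrier) → Injective _≡_ _≡_ rs →
                      ¬ (∀ i → rs i ^ suc (suc m) ≡ rs i)
  fixedPoints-bound m rs injective fixed = 0≢1 (sym (begin
    1#                        ≡⟨ sym (leading-Xpow m) ⟩
    leading (Xpow m)          ≡⟨ sym (leading-cons (- 1#) (Xpow m)) ⟩
    leading (XpowMinusX m)    ≡⟨ rootBound _ (XpowMinusX m) rs injective roots ⟩
    0#                        ∎))
    where
    open ≡-Reasoning
    roots : ∀ i → eval (XpowMinusX m) (rs i) ≡ 0#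
    roots i = root-XpowMinusX m (rs i) (fixed i)

-- For a ≠ 0, multiplication by a permutes 𝔽, so the product U of all
-- elements (with 0 replaced by 1, keeping U ≠ 0) equals the product of the
-- a·b; comparing the two products factor by factor gives aᵠ·U = a·U.
module FiniteFieldFacts {q : ℕ} (𝔽 : FiniteField q) where
  open FiniteField 𝔽
  open FieldFacts field′
  open CommutativeRing commutativeRing using (*-commutativeMonoid)
  open import Algebra.Solver.Ring.NaturalCoefficients.Default commutativeSemiring
  open import Algebra.Properties.CommutativeMonoid.Sum *-commutativeMonoid
    using (sum-cong-≗; sum-permute) renaming (sum to ∏)

  toFin : Carrier → Fin q
  toFin = Inverse.to enum

  fromFin : Fin q → Carrier
  fromFin = Inverse.from enum

  toFin-fromFin : ∀ i → toFin (fromFin i) ≡ i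
  toFin-fromFin = Inverse.strictlyInverseˡ enum

  fromFin-toFin : ∀ x → fromFin (toFin x) ≡ x
  fromFin-toFin = Inverse.strictlyInverseʳ enum

  -- 0 and 1 are distinct elements, so q = m + 2 for some m
  two≤q : ∃ λ m → q ≡ suc (suc m)
  two≤q = at-least-two (toFin 0#) (toFin 1#) 0≢1′
    where
    0≢1′ : toFin 0# ≢ toFin 1#
    0≢1′ e = 0≢1 (trans (sym (fromFin-toFin 0#)) (trans (cong fromFin e) (fromFin-toFin 1#)))
    at-least-two : ∀ {n} (i j : Fin n) → i ≢ j → ∃ λ m → n ≡ suc (suc m)
    at-least-two {suc zero}    zero zero i≢j = ⊥-elim (i≢j refl)
    at-least-two {suc (suc m)} _    _    _   = m , refl

  ∏-scale : ∀ n a (g : Fin n → Carrier) → ∏ (λ i → a * g i) ≡ (a ^ n) * ∏ g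
  ∏-scale zero    a g = sym (*-identityʳ 1#)
  ∏-scale (suc n) a g =
    trans (cong ((a * g zero) *_) (∏-scale n a (g ∘ suc)))
          (regroup a (g zero) (a ^ n) (∏ (g ∘ suc)))
    where
    regroup : ∀ a g aⁿ G → (a * g) * (aⁿ * G) ≡ (a * aⁿ) * (g * G)
    regroup = solve 4 (λ a g aⁿ G → (a :* g) :* (aⁿ :* G) := (a :* aⁿ) :* (g :* G)) refl

  ∏-one-difference : ∀ n (f g : Fin n → Carrier) i₀ c →
    (∀ i → i ≢ i₀ → f i ≡ g i) → f i₀ ≡ c * g i₀ → ∏ f ≡ c * ∏ g
  ∏-one-difference (suc n) f g zero c elsewhere at-i₀ =
    trans (cong₂ _*_ at-i₀ (sum-cong-≗ (λ i → elsewhere (suc i) λ ())))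
          (*-assoc c (g zero) (∏ (g ∘ suc)))
  ∏-one-difference (suc n) f g (suc i₀) c elsewhere at-i₀ =
    trans (cong₂ _*_ (elsewhere zero λ ())
                     (∏-one-difference n (f ∘ suc) (g ∘ suc) i₀ c elsewhere′ at-i₀))
          (swap (g zero) c (∏ (g ∘ suc)))
    where
    elsewhere′ : ∀ i → i ≢ i₀ → f (suc i) ≡ g (suc i)
    elsewhere′ i i≢i₀ = elsewhere (suc i) (λ e → i≢i₀ (suc-injective e))
    swap : ∀ g c G → g * (c * G) ≡ c * (g * G)
    swap = solve 3 (λ g c G → g :* (c :* G) := c :* (g :* G)) refl

  ∏-nonzero : ∀ n (f : Fin n → Carrier) → (∀ i → f i ≢ 0#) → ∏ f ≢ 0#
  ∏-nonzero zero    f _       = λ 1≡0 → 0≢1 (sym 1≡0)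
  ∏-nonzero (suc n) f nonzero = nonzero-* (nonzero zero) (∏-nonzero n (f ∘ suc) (nonzero ∘ suc))

  orOne : Carrier → Carrier
  orOne b with b ≟ 0#
  ... | yes _ = 1#
  ... | no  _ = b

  orOne-nonzero : ∀ b → orOne b ≢ 0#
  orOne-nonzero b with b ≟ 0#
  ... | yes _   = λ 1≡0 → 0≢1 (sym 1≡0)
  ... | no  b≢0 = b≢0

  orOne-of-nonzero : ∀ b → b ≢ 0# → orOne b ≡ b
  orOne-of-nonzero b b≢0 with b ≟ 0#
  ... | yes b≡0 = ⊥-elim (b≢0 b≡0)
  ... | no  _   = refl

  -- aᵠ · U = a · U for U = ∏_b orOne b, which is nonzero and can be cancelled
  fermat-nonzero : ∀ a → a ≢ 0# → a ^ q ≡ a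
  fermat-nonzero a a≢0 with inverse a a≢0
  ... | a⁻¹ , aa⁻¹≡1 = cancelʳ (∏-nonzero q _ (orOne-nonzero ∘ fromFin)) (begin
    (a ^ q) * U                       ≡⟨ sym (∏-scale q a (orOne ∘ fromFin)) ⟩
    ∏ (λ i → a * orOne (fromFin i))   ≡⟨ ∏-one-difference q _ _ (toFin 0#) a elsewhere at-zero ⟩
    a * ∏ (λ i → orOne (a * fromFin i)) ≡⟨ cong (a *_) (sym U-permuted) ⟩
    a * U                             ∎)
    where
    open ≡-Reasoning
    U = ∏ (orOne ∘ fromFin)
    cancel : ∀ x y → x * y ≡ 1# → ∀ b → x * (y * b) ≡ b
    cancel x y xy≡1 b = trans (sym (*-assoc x y b)) (trans (cong (_* b) xy≡1) (*-identityˡ b))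
    scale : Fin q ↔ Fin q
    scale = mk↔ₛ′ (λ i → toFin (a * fromFin i)) (λ j → toFin (a⁻¹ * fromFin j))
      (λ j → trans (cong (λ v → toFin (a * v)) (fromFin-toFin _))
                   (trans (cong toFin (cancel a a⁻¹ aa⁻¹≡1 (fromFin j))) (toFin-fromFin j)))
      (λ i → trans (cong (λ v → toFin (a⁻¹ * v)) (fromFin-toFin _))
                   (trans (cong toFin (cancel a⁻¹ a (trans (*-comm a⁻¹ a) aa⁻¹≡1) (fromFin i)))
                          (toFin-fromFin i)))
    U-permuted : U ≡ ∏ (λ i → orOne (a * fromFin i))
    U-permuted = trans (sum-permute (orOne ∘ fromFin) scale)
                       (sum-cong-≗ {x = orOne ∘ fromFin ∘ Inverse.to scale}
                                   (λ i → cong orOne (fromFin-toFin _)))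
    elsewhere : ∀ i → i ≢ toFin 0# → a * orOne (fromFin i) ≡ orOne (a * fromFin i)
    elsewhere i i≢0 = trans (cong (a *_) (orOne-of-nonzero (fromFin i) b≢0))
                            (sym (orOne-of-nonzero (a * fromFin i) (nonzero-* a≢0 b≢0)))
      where
      b≢0 : fromFin i ≢ 0#
      b≢0 e = i≢0 (trans (sym (toFin-fromFin i)) (cong toFin e))
    at-zero : a * orOne (fromFin (toFin 0#)) ≡ a * orOne (a * fromFin (toFin 0#))
    at-zero = cong (λ v → a * orOne v)
      (trans (fromFin-toFin 0#) (trans (sym (zeroʳ a)) (cong (a *_) (sym (fromFin-toFin 0#)))))

  -- 0ᵠ = 0 since q ≥ 1
  fermat : ∀ a → a ^ q ≡ a
  fermat a with a ≟ 0# | two≤q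
  ... | yes refl | m , refl = zeroˡ _
  ... | no  a≢0  | _        = fermat-nonzero a a≢0

-- Its image
-- is exactly the set of solutions of yᵠ = y in K: the elements of 𝔽 are
-- solutions by Fermat, and there is no room for any further solution since
-- Xᵠ - X has at most q roots.
module Embedding {q : ℕ} (𝔽 : FiniteField q) (K : Field)
                 (ι : FiniteField.Carrier 𝔽 → Field.Carrier K)
                 (ι-+ : ∀ x y → ι (FiniteField._+_ 𝔽 x y) ≡ Field._+_ K (ι x) (ι y))
                 (ι-* : ∀ x y → ι (FiniteField._*_ 𝔽 x y) ≡ Field._*_ K (ι x) (ι y))
                 (ι-1 : ι (FiniteField.1# 𝔽) ≡ Field.1# K) where
  open FiniteField 𝔽 using (field′) renaming
    (Carrier to Fq; _+_ to _+ᶠ_; _*_ to _*ᶠ_; -_ to -ᶠ_; _-_ to _-ᶠ_; _^_ to _^ᶠ_;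
     0# to 0ᶠ; 1# to 1ᶠ; _≟_ to _≟ᶠ_; inverse to inverseᶠ)
  open FiniteFieldFacts 𝔽 using (toFin; fromFin; toFin-fromFin; two≤q; fermat)
  module 𝔽 = FieldFacts field′
  open Field K
  open FieldFacts K
  open Polynomials K using (fixedPoints-bound)
  open import Data.Vec.Properties using (lookup-map)

  ι-0 : ι 0ᶠ ≡ 0#
  ι-0 = x+x≈x⇒x≈0 _ (trans (sym (ι-+ _ _)) (cong ι (𝔽.+-identityʳ _)))

  ι-neg : ∀ x → ι (-ᶠ x) ≡ - ι x
  ι-neg x = inverseˡ-unique _ _ (trans (sym (ι-+ _ x)) (trans (cong ι (𝔽.-‿inverseˡ x)) ι-0))

  ι-pow : ∀ x n → ι (x ^ᶠ n) ≡ ι x ^ n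
  ι-pow x zero    = ι-1
  ι-pow x (suc n) = trans (ι-* x _) (cong (ι x *_) (ι-pow x n))

  -- ι kills no nonzero element: an inverse d of b would give 0 = ι b · ι d = 1
  ι-kernel : ∀ b → ι b ≡ 0# → b ≡ 0ᶠ
  ι-kernel b ιb≡0 with b ≟ᶠ 0ᶠ
  ... | yes b≡0 = b≡0
  ... | no  b≢0 with inverseᶠ b b≢0
  ...   | d , bd≡1 = ⊥-elim (0≢1 (begin
    0#             ≡⟨ sym (zeroˡ (ι d)) ⟩
    0# * ι d       ≡⟨ cong (_* ι d) (sym ιb≡0) ⟩
    ι b * ι d      ≡⟨ sym (ι-* b d) ⟩
    ι (b *ᶠ d)     ≡⟨ cong ι bd≡1 ⟩
    ι 1ᶠ           ≡⟨ ι-1 ⟩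
    1#             ∎))
    where open ≡-Reasoning

  -- hence ι is injective: ι (x - y) = 0 forces x = y
  ι-injective : Injective _≡_ _≡_ ι
  ι-injective {x} {y} ιx≡ιy = 𝔽.sub≡0⇒≡ (ι-kernel (x -ᶠ y) (begin
    ι (x -ᶠ y)       ≡⟨ ι-+ x (-ᶠ y) ⟩
    ι x + ι (-ᶠ y)   ≡⟨ cong₂ _+_ ιx≡ιy (ι-neg y) ⟩
    ι y - ι y        ≡⟨ -‿inverseʳ (ι y) ⟩
    0#               ∎))
    where open ≡-Reasoning

  map-ι-injective : ∀ {k} → Injective _≡_ _≡_ (Vec.map {n = k} ι)
  map-ι-injective {x = []}    {[]}    _ = refl
  map-ι-injective {x = a ∷ x} {b ∷ y} e =
    cong₂ _∷_ (ι-injective (cong Vec.head e)) (map-ι-injective (cong Vec.tail e))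

  evalM-ι : ∀ {k} (p : MPoly Fq k) a →
            evalM K ι p (Vec.map ι a) ≡ ι (evalM field′ (λ c → c) p a)
  evalM-ι (con c)  a = refl
  evalM-ι (var i)  a = lookup-map i ι a
  evalM-ι (p ⊕ p′) a = trans (cong₂ _+_ (evalM-ι p a) (evalM-ι p′ a)) (sym (ι-+ _ _))
  evalM-ι (p ⊗ p′) a = trans (cong₂ _*_ (evalM-ι p a) (evalM-ι p′ a)) (sym (ι-* _ _))
  evalM-ι (neg p)  a = trans (cong -_ (evalM-ι p a)) (sym (ι-neg _))

  image-fixed : ∀ b → ι b ^ q ≡ ι b
  image-fixed b = trans (sym (ι-pow b q)) (cong ι (fermat b))

  fixed⇒image : ∀ y → y ^ q ≡ y → ∃ λ b → ι b ≡ y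
  fixed⇒image y yᵠ≡y with any? (λ i → ι (fromFin i) ≟ y) | two≤q
  ... | yes (i , e) | _        = fromFin i , e
  ... | no  ∉image  | m , refl = ⊥-elim (fixedPoints-bound m roots roots-injective fixed)
    where
    -- y together with the q elements of 𝔽 gives q+1 distinct solutions
    roots : Fin (suc q) → Carrier
    roots zero    = y
    roots (suc i) = ι (fromFin i)
    roots-injective : Injective _≡_ _≡_ roots
    roots-injective {zero}  {zero}  e = refl
    roots-injective {zero}  {suc j} e = ⊥-elim (∉image (j , sym e))
    roots-injective {suc i} {zero}  e = ⊥-elim (∉image (i , e))
    roots-injective {suc i} {suc j} e =
      cong suc (trans (sym (toFin-fromFin i)) (trans (cong toFin (ι-injective e)) (toFin-fromFin j)))
    fixed : ∀ i → roots i ^ q ≡ roots i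
    fixed zero    = yᵠ≡y
    fixed (suc i) = image-fixed (fromFin i)

  image-of-fixed-vector : ∀ {k} (x : Vec Carrier k) → (∀ i → Vec.lookup x i ^ q ≡ Vec.lookup x i) →
                          ∃ λ a → Vec.map ι a ≡ x
  image-of-fixed-vector []      _     = [] , refl
  image-of-fixed-vector (y ∷ x) fixed with fixed⇒image y (fixed zero)
                                         | image-of-fixed-vector x (fixed ∘ suc)
  ... | b , ιb≡y | a , ιa≡x = b ∷ a , cong₂ _∷_ ιb≡y ιa≡x

module SubsetEnumeration where
  open import Data.Fin.Subset using (Subset; inside; outside; ∣_∣)
  open import Data.List as List using (List)
  open import Data.List.Membership.Propositional using (_∈_)
  open import Data.List.Membership.Propositional.Properties
    using (∈-map⁺; ∈-++⁺ˡ; ∈-++⁺ʳ; ∈-filter⁺; ∈-filter⁻)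
  open import Data.List.Relation.Unary.Any using (here)

  ∈-allSubsets : ∀ {n} (H : Subset n) → H ∈ allSubsets n
  ∈-allSubsets []            = here refl
  ∈-allSubsets (inside ∷ H)  = ∈-++⁺ˡ (∈-map⁺ (inside ∷_) (∈-allSubsets H))
  ∈-allSubsets {suc n} (outside ∷ H) =
    ∈-++⁺ʳ (List.map (inside ∷_) (allSubsets n)) (∈-map⁺ (outside ∷_) (∈-allSubsets H))

  ∈-subsetsOfSize⁺ : ∀ {n s} (H : Subset n) → ∣ H ∣ ≡ s → H ∈ subsetsOfSize n s
  ∈-subsetsOfSize⁺ {n} {s} H = ∈-filter⁺ (λ p → ∣ p ∣ ℕ.≟ s) (∈-allSubsets H)

  ∈-subsetsOfSize⁻ : ∀ {n s} (H : Subset n) → H ∈ subsetsOfSize n s → ∣ H ∣ ≡ s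
  ∈-subsetsOfSize⁻ {n} {s} H H∈ = proj₂ (∈-filter⁻ (λ p → ∣ p ∣ ℕ.≟ s) {xs = allSubsets n} H∈)

Σ-≡-irrelevant : ∀ {A : Set} {P : A → Set} → (∀ {a} (p p′ : P a) → p ≡ p′) →
                 ∀ {a b} {p : P a} {p′ : P b} → a ≡ b → (a , p) ≡ (b , p′)
Σ-≡-irrelevant irrelevant {p = p} {p′} refl = cong (_ ,_) (irrelevant p p′)

module CodeVarieties {q : ℕ} (𝔽 : FiniteField q) (K̄ : AlgebraicClosure (FiniteField.field′ 𝔽))
                     (k r : ℕ) (fs : Vec (MPoly (FiniteField.Carrier 𝔽) k) r) where
  open SystematicCode 𝔽 k r fs
  open AlgebraicClosure K̄ using (K; ι; ι-+; ι-*; ι-1)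
  open Embedding 𝔽 K ι ι-+ ι-* ι-1
  open SubsetEnumeration
  open import Data.Fin.Subset using (Subset; inside; outside; ∣_∣)
  open import Data.List as List using (List)
  open import Data.List.Membership.Propositional using (_∈_)
  open import Data.List.Membership.Propositional.Properties using (∈-allFin)
  import Data.List.Relation.Unary.All as All
  open All using (All)
  import Data.List.Relation.Unary.All.Properties as All
  open import Data.Nat using (_<_; _≤_; z≤n; s≤s⁻¹)
  open import Data.Nat.Properties using (_<?_; ≮⇒≥; ≤-trans; n≤1+n; ≤-irrelevant)
  open import Data.Vec.Properties using (lookup-map; lookup-splitAt)
  open import Data.Sum using ([_,_]′)
  open import Axiom.UniquenessOfIdentityProofs using (module Decidable⇒UIP)
  module F = Field F
  module K = Field K
  module FF = FieldFacts F
  module KF = FieldFacts K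

  evalF : MPoly Fq k → Vec Fq k → Fq
  evalF p a = evalM F (λ c → c) p a

  msgWeight : Vec Fq k → ℕ
  msgWeight a = weight (encode a)

  product : ∀ {n} → Vec Fq n → Subset n → Fq
  product []      []            = F.1#
  product (c ∷ v) (inside ∷ H)  = c F.* product v H
  product (c ∷ v) (outside ∷ H) = product v H

  product-vanishes : ∀ {n} (v : Vec Fq n) H → weight v < ∣ H ∣ → product v H ≡ F.0#
  product-vanishes (c ∷ v) (inside ∷ H) lt with c F.≟ F.0#
  ... | yes c≡0 = trans (cong (F._* product v H) c≡0) (FF.zeroˡ _)
  ... | no  _   = trans (cong (c F.*_) (product-vanishes v H (s≤s⁻¹ lt))) (FF.zeroʳ c)
  product-vanishes (c ∷ v) (outside ∷ H) lt with c F.≟ F.0#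
  ... | yes _ = product-vanishes v H lt
  ... | no  _ = product-vanishes v H (≤-trans (n≤1+n _) lt)

  nonvanishing-product : ∀ {n} (v : Vec Fq n) s → s ≤ weight v →
                         ∃ λ H → ∣ H ∣ ≡ s × product v H ≢ F.0#
  nonvanishing-product []      zero    _  = [] , refl , λ 1≡0 → F.0≢1 (sym 1≡0)
  nonvanishing-product (c ∷ v) s       s≤w with c F.≟ F.0#
  nonvanishing-product (c ∷ v) s       s≤w | yes _ with nonvanishing-product v s s≤w
  ... | H , ∣H∣≡s , ∏≢0 = outside ∷ H , ∣H∣≡s , ∏≢0
  nonvanishing-product (c ∷ v) zero    _   | no _ with nonvanishing-product v zero z≤n
  ... | H , ∣H∣≡0 , ∏≢0 = outside ∷ H , ∣H∣≡0 , ∏≢0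
  nonvanishing-product (c ∷ v) (suc s) s≤w | no c≢0 with nonvanishing-product v s (s≤s⁻¹ s≤w)
  ... | H , ∣H∣≡s , ∏≢0 = inside ∷ H , cong suc ∣H∣≡s , FF.nonzero-* c≢0 ∏≢0

  evalF-monomial : ∀ {n} (G : Fin n → MPoly Fq k) (v : Vec Fq n) a →
                   (∀ h → evalF (G h) a ≡ Vec.lookup v h) →
                   ∀ H → evalF (monomial F.1# G H) a ≡ product v H
  evalF-monomial G []      a G≡v []            = refl
  evalF-monomial G (c ∷ v) a G≡v (inside ∷ H)  =
    cong₂ F._*_ (G≡v zero) (evalF-monomial (G ∘ suc) v a (G≡v ∘ suc) H)
  evalF-monomial G (c ∷ v) a G≡v (outside ∷ H) = evalF-monomial (G ∘ suc) v a (G≡v ∘ suc) H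

  evalF-Y : ∀ a h → evalF (Y h) a ≡ Vec.lookup (encode a) h
  evalF-Y a h = trans (by-cases h) (sym (lookup-splitAt k a _ h))
    where
    by-cases : ∀ h → evalF (Y h) a ≡
               [ Vec.lookup a , Vec.lookup (Vec.map (λ f → evalF f a) fs) ]′ (Fin.splitAt k h)
    by-cases h with Fin.splitAt k h
    ... | inj₁ i = refl
    ... | inj₂ j = sym (lookup-map j (λ f → evalF f a) fs)

  monomial-at-codeword : ∀ a H → evalF (monomial F.1# Y H) a ≡ product (encode a) H
  monomial-at-codeword a = evalF-monomial Y (encode a) a (evalF-Y a)

  fieldEquations : List (MPoly Fq k)
  fieldEquations = List.map (λ i → powM F.1# (var i) q ⊖ var i) (List.allFin k)

  monomialGenerators : ℕ → List (MPoly Fq k)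
  monomialGenerators s = List.map (monomial F.1# Y) (subsetsOfSize (k ℕ.+ r) s)

  VanishAt : Vec K.Carrier k → List (MPoly Fq k) → Set
  VanishAt x gs = All (λ g → evalM K ι g x ≡ K.0#) gs

  evalK-powM : ∀ (p : MPoly Fq k) n (x : Vec K.Carrier k) → evalM K ι (powM F.1# p n) x ≡ evalM K ι p x K.^ n
  evalK-powM p zero    x = ι-1
  evalK-powM p (suc n) x = cong (evalM K ι p x K.*_) (evalK-powM p n x)

  fieldEquations-at-image : ∀ a → VanishAt (Vec.map ι a) fieldEquations
  fieldEquations-at-image a = All.map⁺ (All.tabulate λ {i} _ → equation i)
    where
    equation : ∀ i → evalM K ι (powM F.1# (var i) q ⊖ var i) (Vec.map ι a) ≡ K.0#
    equation i = trans (cong (K._- Vec.lookup (Vec.map ι a) i) (evalK-powM (var i) q _))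
                       (trans (cong (λ y → y K.^ q K.- y) (lookup-map i ι a))
                              (trans (cong (K._- ι (Vec.lookup a i)) (image-fixed _))
                                     (KF.-‿inverseʳ _)))

  fieldEquations⇒image : ∀ x → VanishAt x fieldEquations → ∃ λ a → Vec.map ι a ≡ x
  fieldEquations⇒image x vanish = image-of-fixed-vector x fixed
    where
    fixed : ∀ i → Vec.lookup x i K.^ q ≡ Vec.lookup x i
    fixed i = KF.sub≡0⇒≡ (trans (cong (K._- Vec.lookup x i) (sym (evalK-powM (var i) q x)))
                                (All.lookup (All.map⁻ vanish) (∈-allFin i)))

  monomial-at-image : ∀ a H → evalM K ι (monomial F.1# Y H) (Vec.map ι a) ≡ ι (product (encode a) H)
  monomial-at-image a H = trans (evalM-ι (monomial F.1# Y H) a) (cong ι (monomial-at-codeword a H))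

  light⇒monomials-vanish : ∀ s a → msgWeight a < s → VanishAt (Vec.map ι a) (monomialGenerators s)
  light⇒monomials-vanish s a light = All.map⁺ (All.tabulate λ {H} H∈ → vanishes H H∈)
    where
    vanishes : ∀ H → H ∈ subsetsOfSize (k ℕ.+ r) s →
               evalM K ι (monomial F.1# Y H) (Vec.map ι a) ≡ K.0#
    vanishes H H∈ = trans (monomial-at-image a H)
      (trans (cong ι (product-vanishes (encode a) H
                        (subst (msgWeight a <_) (sym (∈-subsetsOfSize⁻ H H∈)) light)))
             ι-0)

  monomials-vanish⇒light : ∀ s a → VanishAt (Vec.map ι a) (monomialGenerators s) → msgWeight a < s
  monomials-vanish⇒light s a vanish with msgWeight a <? s
  ... | yes light = light
  ... | no  heavy with nonvanishing-product (encode a) s (≮⇒≥ heavy)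
  ...   | H , ∣H∣≡s , ∏≢0 = ⊥-elim (∏≢0 (ι-injective (begin
    ι (product (encode a) H)                         ≡⟨ sym (monomial-at-image a H) ⟩
    evalM K ι (monomial F.1# Y H) (Vec.map ι a)      ≡⟨ All.lookup (All.map⁻ vanish) (∈-subsetsOfSize⁺ H ∣H∣≡s) ⟩
    K.0#                                             ≡⟨ sym ι-0 ⟩
    ι F.0#                                           ∎)))
    where open ≡-Reasoning

  variety↔light : ∀ s → Variety K̄ s ↔ Σ (Vec Fq k) (λ a → msgWeight a < s)
  variety↔light s = mk↔ₛ′ to from to∘from from∘to
    where
    message : (y : Variety K̄ s) →
              Σ (Vec Fq k) λ a → Vec.map ι a ≡ proj₁ y × msgWeight a < s
    message (x , vanish) with fieldEquations⇒image x (All.++⁻ˡ fieldEquations vanish)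
    ... | a , refl = a , refl , monomials-vanish⇒light s a (All.++⁻ʳ fieldEquations vanish)
    to : Variety K̄ s → Σ (Vec Fq k) (λ a → msgWeight a < s)
    to y = proj₁ (message y) , proj₂ (proj₂ (message y))
    from : Σ (Vec Fq k) (λ a → msgWeight a < s) → Variety K̄ s
    from (a , light) = Vec.map ι a ,
      All.++⁺ (fieldEquations-at-image a) (light⇒monomials-vanish s a light)
    to∘from : ∀ y → to (from y) ≡ y
    to∘from y = Σ-≡-irrelevant ≤-irrelevant (map-ι-injective (proj₁ (proj₂ (message (from y)))))
    from∘to : ∀ y → from (to y) ≡ y
    from∘to y = Σ-≡-irrelevant (All.irrelevant (Decidable⇒UIP.≡-irrelevant K._≟_))
                               (proj₁ (proj₂ (message y)))

  codewords↔exact : ∀ s → CodewordsOfWeight s ↔ Σ (Vec Fq k) (λ a → msgWeight a ≡ s)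
  codewords↔exact s = mk↔ₛ′ to from (λ _ → refl) from∘to
    where
    to : CodewordsOfWeight s → Σ (Vec Fq k) (λ a → msgWeight a ≡ s)
    to (c , (a , refl) , wt≡s) = a , wt≡s
    from : Σ (Vec Fq k) (λ a → msgWeight a ≡ s) → CodewordsOfWeight s
    from (a , wt≡s) = encode a , (a , refl) , wt≡s
    from∘to : ∀ y → from (to y) ≡ y
    from∘to (c , (a , refl) , wt≡s) = refl

module Counting where
  open import Data.Nat using (_<_; s≤s; s≤s⁻¹)
  open import Data.Nat.Properties
    using (_<?_; ≮⇒≥; ≤-antisym; <-irrefl; m<n⇒m<1+n; ≤-reflexive; ≤-irrelevant; ≡-irrelevant)

  split-below-suc : ∀ {A : Set} (w : A → ℕ) s →
    Σ A (λ a → w a < suc s) ↔ (Σ A (λ a → w a < s) ⊎ Σ A (λ a → w a ≡ s))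
  split-below-suc {A} w s = mk↔ₛ′ to from to∘from from∘to
    where
    to : Σ A (λ a → w a < suc s) → Σ A (λ a → w a < s) ⊎ Σ A (λ a → w a ≡ s)
    to (a , w<1+s) with w a <? s
    ... | yes w<s = inj₁ (a , w<s)
    ... | no  w≮s = inj₂ (a , ≤-antisym (s≤s⁻¹ w<1+s) (≮⇒≥ w≮s))
    from : Σ A (λ a → w a < s) ⊎ Σ A (λ a → w a ≡ s) → Σ A (λ a → w a < suc s)
    from (inj₁ (a , w<s)) = a , m<n⇒m<1+n w<s
    from (inj₂ (a , w≡s)) = a , s≤s (≤-reflexive w≡s)
    to∘from : ∀ y → to (from y) ≡ y
    to∘from (inj₁ (a , w<s)) with w a <? s
    ... | yes _   = cong inj₁ (Σ-≡-irrelevant ≤-irrelevant refl)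
    ... | no  w≮s = ⊥-elim (w≮s w<s)
    to∘from (inj₂ (a , w≡s)) with w a <? s
    ... | yes w<s = ⊥-elim (<-irrefl w≡s w<s)
    ... | no  _   = cong inj₂ (Σ-≡-irrelevant ≡-irrelevant refl)
    from∘to : ∀ y → from (to y) ≡ y
    from∘to (a , _) with w a <? s
    ... | yes _ = Σ-≡-irrelevant ≤-irrelevant refl
    ... | no  _ = Σ-≡-irrelevant ≤-irrelevant refl

  Fin-injective : ∀ {m n} → Fin m ↔ Fin n → m ≡ n
  Fin-injective e = cantor-schröder-bernstein (Injection.injective (↔⇒↣ e))
                                              (Injection.injective (↔⇒↣ (↔-sym e)))

-- Main theorem: B_{t-1} = |V(W_C^t)| - |V(W_C^{t-1})|, i.e. B + m′ = m.
mainTheorem7 : ∀ {q : ℕ} (𝔽 : FiniteField q) (K̄ : AlgebraicClosure (FiniteField.field′ 𝔽))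
    (k r : ℕ) → 1 ℕ.≤ k → 1 ℕ.≤ r →
    (fs : Vec (MPoly (FiniteField.Carrier 𝔽) k) r) →
    (t : ℕ) → 2 ℕ.≤ t → t ℕ.≤ k ℕ.+ r →
    (B m m′ : ℕ) →
    SystematicCode.CodewordsOfWeight 𝔽 k r fs (t ℕ.∸ 1) ↔ Fin B →
    SystematicCode.Variety 𝔽 k r fs K̄ t ↔ Fin m →
    SystematicCode.Variety 𝔽 k r fs K̄ (t ℕ.∸ 1) ↔ Fin m′ →
    B ℕ.+ m′ ≡ m
mainTheorem7 𝔽 K̄ k r _ _ fs (suc s) (ℕ.s≤s _) _ B m m′ codewords variety variety′ =
  trans (+-comm B m′) (sym (Fin-injective counting))
  where
  open SystematicCode 𝔽 k r fs using (Fq; Variety; CodewordsOfWeight)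
  open CodeVarieties 𝔽 K̄ k r fs
  open Counting
  open Related.EquationalReasoning
  counting : Fin m ↔ Fin (m′ ℕ.+ B)
  counting = begin
    Fin m                                                      ↔⟨ variety ⟨
    Variety K̄ (suc s)                                          ↔⟨ variety↔light (suc s) ⟩
    Σ (Vec Fq k) (λ a → msgWeight a ℕ.< suc s)                 ↔⟨ split-below-suc msgWeight s ⟩
    (Σ (Vec Fq k) (λ a → msgWeight a ℕ.< s) ⊎ Σ (Vec Fq k) (λ a → msgWeight a ≡ s))
                      ↔⟨ ↔-sym (variety↔light s) ⊎-↔ ↔-sym (codewords↔exact s) ⟩
    (Variety K̄ s ⊎ CodewordsOfWeight s)                        ↔⟨ variety′ ⊎-↔ codewords ⟩
    (Fin m′ ⊎ Fin B)                                           ↔⟨ +↔⊎ ⟨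
    Fin (m′ ℕ.+ B)                                             ∎
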